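{- A path $\mathfrak p\in L_{n,m}$ is regular in $\mathcal{L}_{n,m}$ if and only if $\mathfrak p$ is the least or the greatest element of $\mathcal{L}_{n,m}$.
   Context: $L_{n,m}$ is the set of lattice paths from $(0,0)$ to $(n,m)$ using up-steps $(0,1)$ and right-steps $(1,0)$; each is determined by its height sequence $(h_1,\dots,h_n)$ ($h_i$ = number of up-steps before the $i$-th right-step). $\mathcal{L}_{n,m}$ is $L_{n,m}$ ordered componentwise by height sequences; it is a finite distributive lattice, hence a Heyting algebra. The pseudocomplement $x^{\mathsf c}$ is the greatest $z$ with $x\wedge z=\hat0$, and $x$ is regular if $(x^{\mathsf c})^{\mathsf c}=x$. -}

module Defs where

open import Data.Nat using (ℕ; _≤_; _⊓_)
open import Data.Fin using (Fin) renaming (_≤_ to _≤ᶠ_)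
open import Data.Vec using (Vec; lookup; zipWith; replicate)
open import Data.Vec.Relation.Unary.All using (All)
open import Data.Vec.Relation.Binary.Pointwise.Inductive using (Pointwise)
open import Data.Product using (_×_; ∃)
open import Relation.Binary.PropositionalEquality using (_≡_)

-- A lattice path in L_{n,m}, given by its height sequence (h_1,...,h_n):
-- weakly increasing with all entries in {0,...,m}.
IsPath : {n : ℕ} → (m : ℕ) → Vec ℕ n → Set
IsPath m h = All (_≤ m) h × (∀ i j → i ≤ᶠ j → lookup h i ≤ lookup h j)

_≤ₚ_ : {n : ℕ} → Vec ℕ n → Vec ℕ n → Set
x ≤ₚ y = Pointwise _≤_ x y

_∧ₚ_ : {n : ℕ} → Vec ℕ n → Vec ℕ n → Vec ℕ n
x ∧ₚ y = zipWith _⊓_ x y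

bot : (n : ℕ) → Vec ℕ n
bot n = replicate n 0

top : (n m : ℕ) → Vec ℕ n
top n m = replicate n m

IsPseudocomplement : (n m : ℕ) → Vec ℕ n → Vec ℕ n → Set
IsPseudocomplement n m x z =
  IsPath m z × (x ∧ₚ z ≡ bot n) ×
  (∀ w → IsPath m w → x ∧ₚ w ≡ bot n → w ≤ₚ z)

-- x is regular: (x^c)^c = x.
Regular : (n m : ℕ) → Vec ℕ n → Set
Regular n m x = ∃ λ z → IsPseudocomplement n m x z × IsPseudocomplement n m z x

-- The last height of a path dominates all its heights, so if x ∧ z = 0̂ then x
-- or z has last height 0 and hence is 0̂. If p = (p^c)^c, then either p^c ≠ 0̂,
-- which forces p = 0̂, or p^c = 0̂ and p = 0̂^c is the top path; conversely 0̂
-- and the top path are each other's pseudocomplements.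
module Submission where

open import Defs
open import Data.Nat using (ℕ; zero; suc; _≤_; _⊓_; z≤n)
open import Data.Nat.Properties using (≤-refl; ≤-reflexive; ≤-antisym; n≤0⇒n≡0; m≥n⇒m⊓n≡n; ⊓-zeroʳ)
open import Data.Fin using (fromℕ)
open import Data.Fin.Properties using (≤fromℕ)
open import Data.Vec using (Vec; []; _∷_; lookup; replicate)
open import Data.Vec.Properties using (lookup-zipWith; lookup-replicate; zipWith-replicate)
open import Data.Vec.Relation.Unary.All using (All; []; _∷_)
open import Data.Vec.Relation.Unary.All.Properties using (lookup⁻)
open import Data.Vec.Relation.Binary.Pointwise.Inductive as Pointwise using ([]; _∷_)
open import Data.Vec.Relation.Binary.Pointwise.Extensional using (ext; Pointwise-≡⇒≡)
open import Data.Product using (_,_)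
open import Data.Sum using (_⊎_; inj₁; inj₂; map)
open import Function.Bundles using (_⇔_; mk⇔)
open import Relation.Binary.PropositionalEquality using (_≡_; refl; sym; trans; cong; cong₂; subst; module ≡-Reasoning)

m⊓n≡0⇒m≡0∨n≡0 : ∀ m n → m ⊓ n ≡ 0 → m ≡ 0 ⊎ n ≡ 0
m⊓n≡0⇒m≡0∨n≡0 zero    n       _  = inj₁ refl
m⊓n≡0⇒m≡0∨n≡0 (suc m) zero    _  = inj₂ refl
m⊓n≡0⇒m≡0∨n≡0 (suc m) (suc n) ()

≤ₚ-antisym : ∀ {n} {x y : Vec ℕ n} → x ≤ₚ y → y ≤ₚ x → x ≡ y
≤ₚ-antisym []       []       = refl
≤ₚ-antisym (p ∷ ps) (q ∷ qs) = cong₂ _∷_ (≤-antisym p q) (≤ₚ-antisym ps qs)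

≤ₚ-replicate : ∀ {n m} {w : Vec ℕ n} → All (_≤ m) w → w ≤ₚ replicate n m
≤ₚ-replicate []       = []
≤ₚ-replicate (p ∷ ps) = p ∷ ≤ₚ-replicate ps

replicate-∧ₚ : ∀ {n m} {w : Vec ℕ n} → All (_≤ m) w → replicate n m ∧ₚ w ≡ w
replicate-∧ₚ []       = refl
replicate-∧ₚ (p ∷ ps) = cong₂ _∷_ (m≥n⇒m⊓n≡n p) (replicate-∧ₚ ps)

lookup-∧ₚ≡bot : ∀ {n} {x z : Vec ℕ n} → x ∧ₚ z ≡ bot n →
  ∀ i → lookup x i ⊓ lookup z i ≡ 0
lookup-∧ₚ≡bot {n} {x} {z} x∧z≡0 i = begin
  lookup x i ⊓ lookup z i   ≡⟨ lookup-zipWith _⊓_ i x z ⟨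
  lookup (x ∧ₚ z) i         ≡⟨ cong (λ v → lookup v i) x∧z≡0 ⟩
  lookup (bot n) i          ≡⟨ lookup-replicate i 0 ⟩
  0                         ∎
  where open ≡-Reasoning

replicate-isPath : ∀ n {m a} → a ≤ m → IsPath m (replicate n a)
replicate-isPath n {a = a} a≤m =
  lookup⁻ (λ i → subst (_≤ _) (sym (lookup-replicate i a)) a≤m) ,
  λ i j _ → ≤-reflexive (trans (lookup-replicate i a) (sym (lookup-replicate j a)))

path-last-zero⇒bot : ∀ {k m} {h : Vec ℕ (suc k)} → IsPath m h →
  lookup h (fromℕ k) ≡ 0 → h ≡ bot (suc k)
path-last-zero⇒bot {k} {h = h} (_ , mono) last≡0 = Pointwise-≡⇒≡ (ext λ i →
  trans (n≤0⇒n≡0 (subst (lookup h i ≤_) last≡0 (mono i (fromℕ k) (≤fromℕ i))))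
        (sym (lookup-replicate i 0)))

paths-∧ₚ≡bot⇒≡bot∨≡bot : ∀ {n m} {x z : Vec ℕ n} → IsPath m x → IsPath m z →
  x ∧ₚ z ≡ bot n → x ≡ bot n ⊎ z ≡ bot n
paths-∧ₚ≡bot⇒≡bot∨≡bot {zero} {x = []} _ _ _ = inj₁ refl
paths-∧ₚ≡bot⇒≡bot∨≡bot {suc k} x-path z-path x∧z≡0 =
  map (path-last-zero⇒bot x-path) (path-last-zero⇒bot z-path)
      (m⊓n≡0⇒m≡0∨n≡0 _ _ (lookup-∧ₚ≡bot x∧z≡0 (fromℕ k)))

pseudocomplement-unique : ∀ {n m} {x z z′ : Vec ℕ n} →
  IsPseudocomplement n m x z → IsPseudocomplement n m x z′ → z ≡ z′
pseudocomplement-unique (z-path , x∧z≡0 , z-max) (z′-path , x∧z′≡0 , z′-max) =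
  ≤ₚ-antisym (z′-max _ z-path x∧z≡0) (z-max _ z′-path x∧z′≡0)

bot-pseudocomplement : ∀ n m → IsPseudocomplement n m (bot n) (top n m)
bot-pseudocomplement n m =
  replicate-isPath n ≤-refl , zipWith-replicate _⊓_ 0 m ,
  λ _ (w-bounded , _) _ → ≤ₚ-replicate w-bounded

top-pseudocomplement : ∀ n m → IsPseudocomplement n m (top n m) (bot n)
top-pseudocomplement n m =
  replicate-isPath n z≤n ,
  trans (zipWith-replicate _⊓_ m 0) (cong (replicate n) (⊓-zeroʳ m)) ,
  λ w (w-bounded , _) top∧w≡0 →
    subst (w ≤ₚ_) (trans (sym (replicate-∧ₚ w-bounded)) top∧w≡0) (Pointwise.refl ≤-refl)

corollary3p4 : (n m : ℕ) (p : Vec ℕ n) → IsPath m p →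
    (Regular n m p ⇔ (p ≡ bot n ⊎ p ≡ top n m))
corollary3p4 n m p p-path = mk⇔ regular⇒extreme extreme⇒regular
  where
  regular⇒extreme : Regular n m p → p ≡ bot n ⊎ p ≡ top n m
  regular⇒extreme (z , (z-path , p∧z≡0 , _) , p-pc-z) with paths-∧ₚ≡bot⇒≡bot∨≡bot p-path z-path p∧z≡0
  ... | inj₁ p≡0 = inj₁ p≡0
  ... | inj₂ refl = inj₂ (pseudocomplement-unique p-pc-z (bot-pseudocomplement n m))

  extreme⇒regular : p ≡ bot n ⊎ p ≡ top n m → Regular n m p
  extreme⇒regular (inj₁ refl) = top n m , bot-pseudocomplement n m , top-pseudocomplement n m
  extreme⇒regular (inj₂ refl) = bot n , top-pseudocomplement n m , bot-pseudocomplement n m
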